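{- For every integer $n\ge 2$ and every integer $k$ with $1-\lceil (n-1)/2\rceil\le k\le\lfloor (n-1)/2\rfloor$, $\mathcal{M}_k(K_n)=\left\lceil\frac{n+2k+1}{2}\right\rceil$.
   Context: All graphs are finite and simple; $K_n$ is the complete graph on $n$ vertices (minimum degree $n-1$). For a vertex $v$, $\delta(v)$ is its degree and $\delta_X(v)=|N(v)\cap X|$. For an integer $k$ with $1-\lceil\delta(G)/2\rceil\le k\le\lfloor\delta(G)/2\rfloor$, a nonempty set $M\subseteq V(G)$ is a $k$-monopoly if every vertex $v$ satisfies $\delta_M(v)\ge\frac{\delta(v)}{2}+k$; $\mathcal{M}_k(G)$ is the minimum cardinality of a $k$-monopoly. -}

module Defs where

open import Data.Nat as ℕ using (ℕ)
open import Data.Integer as ℤ using (ℤ; +_)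
open import Data.Rational using (ℚ; _/_; _+_; _*_; _≤_; ½; floor; ceiling)
open import Data.Fin using (Fin)
open import Data.Fin.Subset using (Subset; ∣_∣; _∩_; _∈_; _∉_; ∁; ⁅_⁆; Nonempty)
open import Data.Product using (Σ; _×_)
open import Relation.Binary.PropositionalEquality using (_≡_)
open import Data.Fin.Subset.Properties using (x∈∁p⇒x∉p; x∉p⇒x∈∁p; x∈⁅x⁆; x∈⁅y⁆⇒x≡y)

record Graph (n : ℕ) : Set where
  field
    N     : Fin n → Subset n
    irrefl : ∀ v → v ∉ N v
    symm  : ∀ u v → u ∈ N v → v ∈ N u
open Graph public

deg : ∀ {n} → Graph n → Fin n → ℕ
deg G v = ∣ N G v ∣

degIn : ∀ {n} → Graph n → Subset n → Fin n → ℕ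
degIn G X v = ∣ N G v ∩ X ∣

ℕ→ℚ : ℕ → ℚ
ℕ→ℚ m = + m / 1

ℤ→ℚ : ℤ → ℚ
ℤ→ℚ z = z / 1

IsKMonopoly : ∀ {n} → Graph n → ℤ → Subset n → Set
IsKMonopoly G k M =
  Nonempty M × (∀ v → ℕ→ℚ (deg G v) * ½ + ℤ→ℚ k ≤ ℕ→ℚ (degIn G M v))

MonopolyNumber : ∀ {n} → Graph n → ℤ → ℕ → Set
MonopolyNumber G k m =
  Σ (Subset _) (λ M → IsKMonopoly G k M × ∣ M ∣ ≡ m)
  × (∀ M → IsKMonopoly G k M → m ℕ.≤ ∣ M ∣)

K : (n : ℕ) → Graph n
K n = record
  { N = λ v → ∁ ⁅ v ⁆
  ; irrefl = λ v v∈ → x∈∁p⇒x∉p v∈ (x∈⁅x⁆ v)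
  ; symm = λ u v u∈ → x∉p⇒x∈∁p (λ v∈⁅u⁆ → x∈∁p⇒x∉p u∈ (helper v∈⁅u⁆))
  }
  where
  helper : ∀ {u v : Fin n} → v ∈ ⁅ u ⁆ → u ∈ ⁅ v ⁆
  helper {u} {v} p with x∈⁅y⁆⇒x≡y u p
  ... | Relation.Binary.PropositionalEquality.refl = x∈⁅x⁆ u

-- In K_n every vertex has degree n - 1 and δ_M(v) = |M| - [v ∈ M], so the monopoly
-- condition is tightest at a vertex of M: a set M is a k-monopoly iff it is nonempty and
-- 2 (|M| - 1) ≥ n - 1 + 2k.  Hence 𝓜_k(K_n) is the least m with 2m ≥ n + 2k + 1, attained
-- by any m vertices; the bounds on k put n - 1 + 2k in [0, 2(n - 1)], so that 1 ≤ m ≤ n.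
module Submission where

open import Defs
open import Data.Nat using (ℕ; _≥_)
open import Data.Integer using (ℤ; +_; _-_)
open import Data.Rational using (ℚ; _/_; floor; ceiling)
open import Relation.Binary.PropositionalEquality using (_≡_)
open import Data.Product using (Σ; _×_)

open import Data.Nat as ℕ using (zero; suc; _≤_; z≤n; s≤s; ⌊_/2⌋; ⌈_/2⌉)
import Data.Nat.Properties as ℕP
import Data.Nat.DivMod as ℕD
open import Data.Nat.Coprimality as Coprime using (Coprime; coprime-+; 1-coprimeTo)
open import Data.Integer as ℤ using (+[1+_]; -[1+_]; +≤+)
import Data.Integer.Properties as ℤP
open import Data.Integer.DivMod using (div-pos-is-/ℕ)
open import Data.Integer.Tactic.RingSolver using (solve-∀)
open import Data.Rational as ℚ using (mkℚ; _+_; _*_; ½; toℚᵘ)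
open import Data.Rational.Properties
  using ( toℚᵘ-homo-+; toℚᵘ-homo-*; toℚᵘ-fromℚᵘ; toℚᵘ-mono-≤; toℚᵘ-cancel-≤
        ; fromℚᵘ-cong; normalize-coprime)
open import Data.Rational.Unnormalised as ℚᵘ using (mkℚᵘ; *≤*; *≡*)
import Data.Rational.Unnormalised.Properties as ℚᵘP
open import Data.Fin using (Fin; zero; suc)
open import Data.Fin.Subset using (Subset; ∣_∣; _∩_; _∈_; ∁; ⁅_⁆; ⊥; ⊤; inside; outside; Nonempty)
open import Data.Fin.Subset.Properties using (∩-identityˡ; ∣⊥∣≡0; ∣∁p∣≡n∸∣p∣; ∣⁅x⁆∣≡1)
open import Data.Vec using (_∷_; here; there)
open import Data.Product using (_,_)
open import Function.Bundles using (_⇔_; mk⇔; Equivalence)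
open import Relation.Binary.PropositionalEquality using (refl; sym; trans; cong; subst; subst₂)

-- Unnormalised rational arithmetic does no gcd reduction, so the two sides can be
-- cross-multiplied and compared by the ring solver.
toℚᵘ-a*½+k : ∀ a k → toℚᵘ (ℕ→ℚ a * ½ + ℤ→ℚ k) ℚᵘ.≃ mkℚᵘ (+ a ℤ.+ (k ℤ.+ k)) 1
toℚᵘ-a*½+k a k = ℚᵘP.≃-trans (toℚᵘ-homo-+ (ℕ→ℚ a * ½) (ℤ→ℚ k))
  (ℚᵘP.≃-trans
    (ℚᵘP.+-cong
      (ℚᵘP.≃-trans (toℚᵘ-homo-* (ℕ→ℚ a) ½) (ℚᵘP.*-cong (toℚᵘ-fromℚᵘ (mkℚᵘ (+ a) 0)) ℚᵘP.≃-refl))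
      (toℚᵘ-fromℚᵘ (mkℚᵘ k 0)))
    (*≡* (crossMultiplied (+ a) k)))
  where
  crossMultiplied : ∀ x k → (x ℤ.* + 1 ℤ.* + 1 ℤ.+ k ℤ.* + 2) ℤ.* + 2 ≡ (x ℤ.+ (k ℤ.+ k)) ℤ.* + 2
  crossMultiplied = solve-∀

a*½+k≤d⇔a+2k≤d+d : ∀ a k d →
  (ℕ→ℚ a * ½ + ℤ→ℚ k ℚ.≤ ℕ→ℚ d) ⇔ (+ a ℤ.+ (k ℤ.+ k) ℤ.≤ + (d ℕ.+ d))
a*½+k≤d⇔a+2k≤d+d a k d = mk⇔
  (λ le → unfold (ℚᵘP.≤-respʳ-≃ d≃ (ℚᵘP.≤-respˡ-≃ (toℚᵘ-a*½+k a k) (toℚᵘ-mono-≤ le))))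
  (λ le → toℚᵘ-cancel-≤ (ℚᵘP.≤-respʳ-≃ (ℚᵘP.≃-sym d≃)
            (ℚᵘP.≤-respˡ-≃ (ℚᵘP.≃-sym (toℚᵘ-a*½+k a k)) (fold le))))
  where
  d≃ : toℚᵘ (ℕ→ℚ d) ℚᵘ.≃ mkℚᵘ (+ d) 0
  d≃ = toℚᵘ-fromℚᵘ (mkℚᵘ (+ d) 0)
  d*2≡d+d : + d ℤ.* + 2 ≡ + (d ℕ.+ d)
  d*2≡d+d = trans (double (+ d)) (sym (ℤP.pos-+ d d))
    where
    double : ∀ x → x ℤ.* + 2 ≡ x ℤ.+ x
    double = solve-∀
  unfold : mkℚᵘ (+ a ℤ.+ (k ℤ.+ k)) 1 ℚᵘ.≤ mkℚᵘ (+ d) 0 → + a ℤ.+ (k ℤ.+ k) ℤ.≤ + (d ℕ.+ d)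
  unfold (*≤* le) = subst₂ ℤ._≤_ (ℤP.*-identityʳ _) d*2≡d+d le
  fold : + a ℤ.+ (k ℤ.+ k) ℤ.≤ + (d ℕ.+ d) → mkℚᵘ (+ a ℤ.+ (k ℤ.+ k)) 1 ℚᵘ.≤ mkℚᵘ (+ d) 0
  fold le = *≤* (subst₂ ℤ._≤_ (sym (ℤP.*-identityʳ _)) (sym d*2≡d+d) le)

i/ℕ1≡i : ∀ i → i ℤ./ℕ 1 ≡ i
i/ℕ1≡i (+ n) = cong +_ (ℕD.n/1≡n n)
i/ℕ1≡i -[1+ n ] rewrite ℕD.n%1≡0 (suc n) = cong (λ m → ℤ.- (+ m)) (ℕD.n/1≡n (suc n))

floor-integer : ∀ i .{c : Coprime ℤ.∣ i ∣ 1} → floor (mkℚ i 0 c) ≡ i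
floor-integer i = trans (div-pos-is-/ℕ i 1) (i/ℕ1≡i i)

ceiling-integer : ∀ i .{c : Coprime ℤ.∣ i ∣ 1} → ceiling (mkℚ i 0 c) ≡ i
ceiling-integer (+ zero) = refl
ceiling-integer +[1+ n ] {c} = cong ℤ.-_ (floor-integer -[1+ n ] {c})
ceiling-integer -[1+ n ] {c} = cong ℤ.-_ (floor-integer +[1+ n ] {c})

data Parity : ℕ → Set where
  even : ∀ q → Parity (q ℕ.* 2)
  odd  : ∀ q → Parity (suc (q ℕ.* 2))

parity : ∀ n → Parity n
parity zero = even 0
parity (suc n) with parity n
... | even q = odd q
... | odd q = even (suc q)

⌊q*2/2⌋≡q : ∀ q → ⌊ q ℕ.* 2 /2⌋ ≡ q
⌊q*2/2⌋≡q zero = refl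
⌊q*2/2⌋≡q (suc q) = cong suc (⌊q*2/2⌋≡q q)

⌊1+q*2/2⌋≡q : ∀ q → ⌊ suc (q ℕ.* 2) /2⌋ ≡ q
⌊1+q*2/2⌋≡q zero = refl
⌊1+q*2/2⌋≡q (suc q) = cong suc (⌊1+q*2/2⌋≡q q)

n/2≡⌊n/2⌋ : ∀ n → n ℕ./ 2 ≡ ⌊ n /2⌋
n/2≡⌊n/2⌋ zero = refl
n/2≡⌊n/2⌋ (suc zero) = refl
n/2≡⌊n/2⌋ (suc (suc n)) =
  trans (ℕD.m/n≡1+[m∸n]/n {suc (suc n)} {2} (s≤s (s≤s z≤n))) (cong suc (n/2≡⌊n/2⌋ n))

coprime-1+q*2-2 : ∀ q → Coprime (suc (q ℕ.* 2)) 2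
coprime-1+q*2-2 zero = 1-coprimeTo 2
coprime-1+q*2-2 (suc q) = coprime-+ (coprime-1+q*2-2 q)

q*2/2≡q : ∀ q → + (q ℕ.* 2) / 2 ≡ mkℚ (+ q) 0 (Coprime.sym (1-coprimeTo q))
q*2/2≡q q = trans
  (fromℚᵘ-cong {mkℚᵘ (+ (q ℕ.* 2)) 1} {mkℚᵘ (+ q) 0} (*≡* (trans (ℤP.*-identityʳ _) (ℤP.pos-* q 2))))
  (normalize-coprime (Coprime.sym (1-coprimeTo q)))

floor-n/2 : ∀ n → floor (+ n / 2) ≡ + ⌊ n /2⌋
floor-n/2 n with parity n
... | even q rewrite q*2/2≡q q =
  trans (floor-integer (+ q) {Coprime.sym (1-coprimeTo q)}) (cong +_ (sym (⌊q*2/2⌋≡q q)))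
... | odd q rewrite normalize-coprime {suc (q ℕ.* 2)} {1} (coprime-1+q*2-2 q) =
  trans (div-pos-is-/ℕ (+ suc (q ℕ.* 2)) 2) (cong +_ (n/2≡⌊n/2⌋ (suc (q ℕ.* 2))))

[1+q*2]%2≡1 : ∀ q → suc (q ℕ.* 2) ℕ.% 2 ≡ 1
[1+q*2]%2≡1 q = ℕD.[m+kn]%n≡m%n 1 q 2

-[1+q*2]/ℕ2≡-[1+q] : ∀ q → -[1+ q ℕ.* 2 ] ℤ./ℕ 2 ≡ -[1+ q ]
-[1+q*2]/ℕ2≡-[1+q] q rewrite [1+q*2]%2≡1 q =
  cong -[1+_] (trans (n/2≡⌊n/2⌋ (suc (q ℕ.* 2))) (⌊1+q*2/2⌋≡q q))

ceiling-n/2 : ∀ n → ceiling (+ n / 2) ≡ + ⌈ n /2⌉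
ceiling-n/2 n with parity n
... | even q rewrite q*2/2≡q q =
  trans (ceiling-integer (+ q) {Coprime.sym (1-coprimeTo q)}) (cong +_ (sym (⌊1+q*2/2⌋≡q q)))
... | odd q rewrite normalize-coprime {suc (q ℕ.* 2)} {1} (coprime-1+q*2-2 q) =
  trans (cong ℤ.-_ (trans (div-pos-is-/ℕ -[1+ q ℕ.* 2 ] 2) (-[1+q*2]/ℕ2≡-[1+q] q)))
        (cong +[1+_] (sym (⌊q*2/2⌋≡q q)))

⌊n/2⌋+⌊n/2⌋≤n : ∀ n → ⌊ n /2⌋ ℕ.+ ⌊ n /2⌋ ≤ n
⌊n/2⌋+⌊n/2⌋≤n n =
  ℕP.≤-trans (ℕP.+-monoʳ-≤ ⌊ n /2⌋ (ℕP.⌊n/2⌋≤⌈n/2⌉ n)) (ℕP.≤-reflexive (ℕP.⌊n/2⌋+⌈n/2⌉≡n n))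

n≤⌈n/2⌉+⌈n/2⌉ : ∀ n → n ≤ ⌈ n /2⌉ ℕ.+ ⌈ n /2⌉
n≤⌈n/2⌉+⌈n/2⌉ n =
  ℕP.≤-trans (ℕP.≤-reflexive (sym (ℕP.⌊n/2⌋+⌈n/2⌉≡n n))) (ℕP.+-monoˡ-≤ ⌈ n /2⌉ (ℕP.⌊n/2⌋≤⌈n/2⌉ n))

⌈n/2⌉≤1+⌊n/2⌋ : ∀ n → ⌈ n /2⌉ ≤ suc ⌊ n /2⌋
⌈n/2⌉≤1+⌊n/2⌋ zero = z≤n
⌈n/2⌉≤1+⌊n/2⌋ (suc zero) = s≤s z≤n
⌈n/2⌉≤1+⌊n/2⌋ (suc (suc n)) = s≤s (⌈n/2⌉≤1+⌊n/2⌋ n)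

∁⊥≡⊤ : ∀ n → ∁ (⊥ {n}) ≡ ⊤
∁⊥≡⊤ zero = refl
∁⊥≡⊤ (suc n) = cong (inside ∷_) (∁⊥≡⊤ n)

∣∁⊥∩p∣≡∣p∣ : ∀ {n} (p : Subset n) → ∣ ∁ ⊥ ∩ p ∣ ≡ ∣ p ∣
∣∁⊥∩p∣≡∣p∣ {n} p rewrite ∁⊥≡⊤ n | ∩-identityˡ p = refl

deg-K : ∀ a v → deg (K (suc a)) v ≡ a
deg-K a v = trans (∣∁p∣≡n∸∣p∣ ⁅ v ⁆) (cong (suc a ℕ.∸_) (∣⁅x⁆∣≡1 v))

∣M∣≤1+degIn-K : ∀ {n} (M : Subset n) v → ∣ M ∣ ≤ suc (degIn (K n) M v)
∣M∣≤1+degIn-K (inside ∷ M) zero rewrite ∣∁⊥∩p∣≡∣p∣ M = ℕP.≤-refl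
∣M∣≤1+degIn-K (outside ∷ M) zero rewrite ∣∁⊥∩p∣≡∣p∣ M = ℕP.n≤1+n _
∣M∣≤1+degIn-K (inside ∷ M) (suc v) = s≤s (∣M∣≤1+degIn-K M v)
∣M∣≤1+degIn-K (outside ∷ M) (suc v) = ∣M∣≤1+degIn-K M v

∈⇒1+degIn-K≤∣M∣ : ∀ {n} (M : Subset n) v → v ∈ M → suc (degIn (K n) M v) ≤ ∣ M ∣
∈⇒1+degIn-K≤∣M∣ (inside ∷ M) zero here rewrite ∣∁⊥∩p∣≡∣p∣ M = ℕP.≤-refl
∈⇒1+degIn-K≤∣M∣ (inside ∷ M) (suc v) (there v∈M) = s≤s (∈⇒1+degIn-K≤∣M∣ M v v∈M)
∈⇒1+degIn-K≤∣M∣ (outside ∷ M) (suc v) (there v∈M) = ∈⇒1+degIn-K≤∣M∣ M v v∈M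

prefix : ∀ {m n} → m ≤ n → Subset n
prefix {zero} _ = ⊥
prefix {suc m} (s≤s m≤n) = inside ∷ prefix m≤n

∣prefix∣≡m : ∀ {m n} (m≤n : m ≤ n) → ∣ prefix m≤n ∣ ≡ m
∣prefix∣≡m {zero} {n} _ = ∣⊥∣≡0 n
∣prefix∣≡m {suc m} (s≤s m≤n) = cong suc (∣prefix∣≡m m≤n)

module CompleteGraph (a : ℕ) (k : ℤ) (t : ℕ) (t≡a+2k : + t ≡ + a ℤ.+ (k ℤ.+ k)) where

  vertexCondition⇔ : ∀ v d →
    (ℕ→ℚ (deg (K (suc a)) v) * ½ + ℤ→ℚ k ℚ.≤ ℕ→ℚ d) ⇔ (t ≤ d ℕ.+ d)
  vertexCondition⇔ v d rewrite deg-K a v = mk⇔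
    (λ le → ℤP.drop‿+≤+ (subst (ℤ._≤ _) (sym t≡a+2k) (Equivalence.to halfBound le)))
    (λ le → Equivalence.from halfBound (subst (ℤ._≤ _) t≡a+2k (+≤+ le)))
    where
    halfBound : (ℕ→ℚ a * ½ + ℤ→ℚ k ℚ.≤ ℕ→ℚ d) ⇔ (+ a ℤ.+ (k ℤ.+ k) ℤ.≤ + (d ℕ.+ d))
    halfBound = a*½+k≤d⇔a+2k≤d+d a k d

  isKMonopoly⇒ : ∀ M → IsKMonopoly (K (suc a)) k M → suc (suc t) ≤ ∣ M ∣ ℕ.+ ∣ M ∣
  isKMonopoly⇒ M ((v , v∈M) , condition) = ℕP.≤-trans
    (s≤s (s≤s (Equivalence.to (vertexCondition⇔ v d) (condition v))))
    (ℕP.≤-trans (ℕP.≤-reflexive (cong suc (sym (ℕP.+-suc d d)))) (ℕP.+-mono-≤ 1+d≤∣M∣ 1+d≤∣M∣))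
    where
    d : ℕ
    d = degIn (K (suc a)) M v
    1+d≤∣M∣ : suc d ≤ ∣ M ∣
    1+d≤∣M∣ = ∈⇒1+degIn-K≤∣M∣ M v v∈M

  isKMonopoly⇐ : ∀ M → Nonempty M → suc (suc t) ≤ ∣ M ∣ ℕ.+ ∣ M ∣ → IsKMonopoly (K (suc a)) k M
  isKMonopoly⇐ M nonempty bound = nonempty , λ v →
    Equivalence.from (vertexCondition⇔ v (d v))
      (ℕP.≤-pred (ℕP.≤-pred (ℕP.≤-trans bound (∣M∣+∣M∣≤2+d+d v))))
    where
    d : Fin (suc a) → ℕ
    d = degIn (K (suc a)) M
    ∣M∣+∣M∣≤2+d+d : ∀ v → ∣ M ∣ ℕ.+ ∣ M ∣ ≤ suc (suc (d v ℕ.+ d v))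
    ∣M∣+∣M∣≤2+d+d v = ℕP.≤-trans (ℕP.+-mono-≤ (∣M∣≤1+degIn-K M v) (∣M∣≤1+degIn-K M v))
                                 (ℕP.≤-reflexive (cong suc (ℕP.+-suc (d v) (d v))))

  monopolyNumber : t ≤ a ℕ.+ a → MonopolyNumber (K (suc a)) k ⌈ suc (suc t) /2⌉
  monopolyNumber t≤a+a = (M , M-monopoly , ∣M∣≡m) , minimal
    where
    m : ℕ
    m = ⌈ suc (suc t) /2⌉
    m≤1+a : m ≤ suc a
    m≤1+a = s≤s (ℕP.≤-trans (ℕP.⌈n/2⌉-mono t≤a+a) (ℕP.≤-reflexive (sym (ℕP.n≡⌈n+n/2⌉ a))))
    M : Subset (suc a)
    M = prefix m≤1+a
    ∣M∣≡m : ∣ M ∣ ≡ m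
    ∣M∣≡m = ∣prefix∣≡m m≤1+a
    M-monopoly : IsKMonopoly (K (suc a)) k M
    M-monopoly = isKMonopoly⇐ M (zero , here)
      (subst (λ x → suc (suc t) ≤ x ℕ.+ x) (sym ∣M∣≡m) (n≤⌈n/2⌉+⌈n/2⌉ (suc (suc t))))
    minimal : ∀ M′ → IsKMonopoly (K (suc a)) k M′ → m ≤ ∣ M′ ∣
    minimal M′ M′-monopoly = ℕP.≤-trans (ℕP.⌈n/2⌉-mono (isKMonopoly⇒ M′ M′-monopoly))
                                         (ℕP.≤-reflexive (sym (ℕP.n≡⌈n+n/2⌉ ∣ M′ ∣)))

1-⌈a/2⌉≤k⇒0≤a+2k : ∀ a k → + 1 - + ⌈ a /2⌉ ℤ.≤ k → + 0 ℤ.≤ + a ℤ.+ (k ℤ.+ k)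
1-⌈a/2⌉≤k⇒0≤a+2k a k 1-c≤k = begin
  + 0                                 ≤⟨ ℤP.+-mono-≤ (ℤP.i≤j⇒0≤j-i (+≤+ (⌈n/2⌉≤1+⌊n/2⌋ a))) (+≤+ z≤n) ⟩
  (+ suc f - + c) ℤ.+ + 1             ≡⟨ rearrange (+ f) (+ c) ⟩
  + (f ℕ.+ c) ℤ.+ (1-c ℤ.+ 1-c)       ≡⟨ cong (λ x → + x ℤ.+ (1-c ℤ.+ 1-c)) (ℕP.⌊n/2⌋+⌈n/2⌉≡n a) ⟩
  + a ℤ.+ (1-c ℤ.+ 1-c)               ≤⟨ ℤP.+-monoʳ-≤ (+ a) (ℤP.+-mono-≤ 1-c≤k 1-c≤k) ⟩
  + a ℤ.+ (k ℤ.+ k)                   ∎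
  where
  open ℤP.≤-Reasoning
  f c : ℕ
  f = ⌊ a /2⌋
  c = ⌈ a /2⌉
  1-c : ℤ
  1-c = + 1 - + c
  rearrange : ∀ F C → (+ 1 ℤ.+ F - C) ℤ.+ + 1 ≡ (F ℤ.+ C) ℤ.+ ((+ 1 - C) ℤ.+ (+ 1 - C))
  rearrange = solve-∀

k≤⌊a/2⌋⇒a+2k≤a+a : ∀ a k → k ℤ.≤ + ⌊ a /2⌋ → + a ℤ.+ (k ℤ.+ k) ℤ.≤ + (a ℕ.+ a)
k≤⌊a/2⌋⇒a+2k≤a+a a k k≤f = begin
  + a ℤ.+ (k ℤ.+ k)     ≤⟨ ℤP.+-monoʳ-≤ (+ a) (ℤP.+-mono-≤ k≤f k≤f) ⟩
  + a ℤ.+ + (f ℕ.+ f)   ≤⟨ ℤP.+-monoʳ-≤ (+ a) (+≤+ (⌊n/2⌋+⌊n/2⌋≤n a)) ⟩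
  + (a ℕ.+ a)           ∎
  where
  open ℤP.≤-Reasoning
  f : ℕ
  f = ⌊ a /2⌋

corollary8 : (n : ℕ) → n ≥ 2 → (k : ℤ) →
    Data.Integer._≤_ (+ 1 - ceiling (+ (n Data.Nat.∸ 1) / 2)) k →
    Data.Integer._≤_ k (floor (+ (n Data.Nat.∸ 1) / 2)) →
    Σ ℕ (λ m → MonopolyNumber (K n) k m × + m ≡ ceiling ((+ n Data.Integer.+ (+ 2 Data.Integer.* k) Data.Integer.+ + 1) / 2))
corollary8 zero ()
corollary8 (suc a) _ k lower upper =
  ⌈ suc (suc t) /2⌉ , CompleteGraph.monopolyNumber a k t t≡a+2k t≤a+a , sym ceiling≡
  where
  0≤a+2k : + 0 ℤ.≤ + a ℤ.+ (k ℤ.+ k)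
  0≤a+2k = 1-⌈a/2⌉≤k⇒0≤a+2k a k (subst (λ c → + 1 - c ℤ.≤ k) (ceiling-n/2 a) lower)
  t : ℕ
  t = ℤ.∣ + a ℤ.+ (k ℤ.+ k) ∣
  t≡a+2k : + t ≡ + a ℤ.+ (k ℤ.+ k)
  t≡a+2k = ℤP.0≤i⇒+∣i∣≡i 0≤a+2k
  t≤a+a : t ≤ a ℕ.+ a
  t≤a+a = ℤP.drop‿+≤+ (subst (ℤ._≤ _) (sym t≡a+2k)
            (k≤⌊a/2⌋⇒a+2k≤a+a a k (subst (k ℤ.≤_) (floor-n/2 a) upper)))
  numerator≡ : + suc a ℤ.+ (+ 2 ℤ.* k) ℤ.+ + 1 ≡ + suc (suc t)
  numerator≡ = trans (regroup (+ a) k) (cong (ℤ._+_ (+ 2)) (sym t≡a+2k))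
    where
    regroup : ∀ A K → (+ 1 ℤ.+ A) ℤ.+ (+ 2 ℤ.* K) ℤ.+ + 1 ≡ + 2 ℤ.+ (A ℤ.+ (K ℤ.+ K))
    regroup = solve-∀
  ceiling≡ : ceiling ((+ suc a ℤ.+ (+ 2 ℤ.* k) ℤ.+ + 1) / 2) ≡ + ⌈ suc (suc t) /2⌉
  ceiling≡ = trans (cong (λ z → ceiling (z / 2)) numerator≡) (ceiling-n/2 (suc (suc t)))
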